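{- As formal power series in $t$ (with $x,y,z$ real parameters), \[ \sum_{n=0}^\infty \xi(P_n;x,y,z)\, t^n = \frac{1-yt}{1-(x+y)t -zt^2}, \qquad \sum_{n=0}^\infty \xi(C_n;x,y,z)\, t^n = \frac{1+zt^2}{1-(x+y)t-zt^2} + \frac{(xy-y+z)t}{1-yt}. \]
   Context: All graphs are finite and undirected and may have loops and multiple edges. For a graph $G$ and an edge $e$: $G_{ -e}$ is the graph obtained by removing $e$; $G_{/e}$ is the graph obtained by removing $e$ and identifying its endpoints; $G_{\dagger e}$ is the graph obtained by removing $e$ and all vertices incident with $e$. $P_n$ denotes the simple path with $n$ vertices ($n=0,1,\dots$; $P_0$ is the empty graph). For $n\ge 1$, $C_n$ denotes the connected 2-regular graph with $n$ vertices ($C_1$ is a vertex with a loop, $C_2$ is two vertices joined by two parallel edges), and $C_0$ is the empty graph. $\oplus$ denotes disjoint union. The universal edge elimination polynomial $\xi(G;x,y,z)$ is defined by $\xi(P_0;x,y,z)=1$, $\xi(P_1;x,y,z)=x$, $\xi(G;x,y,z) = \xi(G_{ -e};x,y,z) + y\,\xi(G_{/e};x,y,z) + z\,\xi(G_{\dagger e};x,y,z)$ for every edge $e$ of $G$, and $\xi(G_1\oplus G_2;x,y,z)=\xi(G_1;x,y,z)\,\xi(G_2;x,y,z)$. -}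

module Defs where

open import Level using (Level)
open import Data.Nat using (ℕ; zero; suc) renaming (_+_ to _+ℕ_)
open import Data.Fin using (Fin; zero; suc; punchOut; _↑ˡ_; _↑ʳ_; fromℕ)
open import Data.Fin.Properties using (_≟_)
open import Data.List using (List; []; _∷_; length; lookup; removeAt; map; mapMaybe; _++_)
open import Data.Maybe using (Maybe; just; nothing)
open import Data.Product using (Σ; _×_; _,_; proj₁)
open import Relation.Nullary using (yes; no)
open import Relation.Binary.PropositionalEquality using (_≢_; sym)
open import Algebra.Bundles using (CommutativeRing)

-- Finite multigraphs (loops and parallel edges allowed).
-- Vertex set Fin V; edges are a list of (unordered) endpoint pairs.

record Graph : Set where
  constructor graph
  field
    V : ℕ
    E : List (Fin V × Fin V)
open Graph public

Edge : Graph → Set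
Edge G = Fin (length (E G))

endpoints : (G : Graph) → Edge G → Fin (V G) × Fin (V G)
endpoints G e = lookup (E G) e

deleteEdge : (G : Graph) → Edge G → Graph
deleteEdge (graph n es) e = graph n (removeAt es e)

dropAt : {n : ℕ} → Fin (suc n) → Fin (suc n) × Fin (suc n) → Maybe (Fin n × Fin n)
dropAt j (a , b) with a ≟ j | b ≟ j
... | no a≢j | no b≢j = just (punchOut (λ p → a≢j (sym p)) , punchOut (λ p → b≢j (sym p)))
... | _ | _ = nothing

minusVertex : (G : Graph) → Fin (V G) → Graph
minusVertex (graph (suc n) es) j = graph n (mapMaybe (dropAt j) es)

mergeVertex : {n : ℕ} (u v : Fin (suc n)) → u ≢ v → Fin (suc n) → Fin n
mergeVertex u v u≢v w with w ≟ v
... | yes _ = punchOut (λ p → u≢v (sym p))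
... | no w≢v = punchOut (λ p → w≢v (sym p))

identify : (n : ℕ) → List (Fin n × Fin n) → Fin n × Fin n → Σ Graph (λ H → Fin (V H))
identify (suc n) es (u , v) with u ≟ v
... | yes _ = graph (suc n) es , u
... | no u≢v = graph n (map (λ { (a , b) → (f a , f b) }) es) , f u
  where f = mergeVertex u v u≢v

contractWithVertex : (G : Graph) → Edge G → Σ Graph (λ H → Fin (V H))
contractWithVertex (graph n es) e = identify n (removeAt es e) (lookup es e)

contractEdge : (G : Graph) → Edge G → Graph
contractEdge G e = proj₁ (contractWithVertex G e)

-- G_{†e}: remove e and its endpoints (and hence all edges incident with them);
-- realised as deleting the merged vertex of G_{/e}.
daggerEdge : (G : Graph) → Edge G → Graph
daggerEdge G e with contractWithVertex G e
... | H , w = minusVertex H w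

_⊕_ : Graph → Graph → Graph
graph m es ⊕ graph n fs =
  graph (m +ℕ n) (map (λ { (a , b) → (a ↑ˡ n , b ↑ˡ n) }) es ++ map (λ { (a , b) → (m ↑ʳ a , m ↑ʳ b) }) fs)

pathEdges : (n : ℕ) → List (Fin n × Fin n)
pathEdges zero = []
pathEdges (suc zero) = []
pathEdges (suc (suc n)) = (zero , suc zero) ∷ map (λ { (a , b) → (suc a , suc b) }) (pathEdges (suc n))

P : ℕ → Graph
P n = graph n (pathEdges n)

-- C_n : P_n plus the edge {n-1, 0}; C_1 is a loop, C_2 a double edge, C_0 empty
C : ℕ → Graph
C zero = graph zero []
C (suc m) = graph (suc m) ((fromℕ m , zero) ∷ pathEdges (suc m))

record IsXi {c ℓ} (R : CommutativeRing c ℓ) (x y z : CommutativeRing.Carrier R)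
            (ξ : Graph → CommutativeRing.Carrier R) : Set (c Level.⊔ ℓ) where
  open CommutativeRing R
  field
    empty : ξ (P 0) ≈ 1#
    single : ξ (P 1) ≈ x
    elim : ∀ (G : Graph) (e : Edge G) →
           ξ G ≈ ξ (deleteEdge G e) + (y * ξ (contractEdge G e) + z * ξ (daggerEdge G e))
    mult : ∀ (G H : Graph) → ξ (G ⊕ H) ≈ ξ G * ξ H

module Series {c ℓ} (R : CommutativeRing c ℓ) where
  open CommutativeRing R

  FPS : Set c
  FPS = ℕ → Carrier

  -- polynomial with the given coefficient list (constant term first)
  poly : List Carrier → FPS
  poly [] _ = 0#
  poly (a ∷ as) zero = a
  poly (a ∷ as) (suc n) = poly as n

  -- Cauchy product: (f ⊛ g) n = Σ_{k=0}^{n} f k * g (n - k)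
  _⊛_ : FPS → FPS → FPS
  (f ⊛ g) zero = f 0 * g 0
  (f ⊛ g) (suc n) = f 0 * g (suc n) + ((λ k → f (suc k)) ⊛ g) n

  _⊞_ : FPS → FPS → FPS
  (f ⊞ g) n = f n + g n

  _≈ₛ_ : FPS → FPS → Set ℓ
  f ≈ₛ g = ∀ n → f n ≈ g n

module Submission where

-- Eliminating the first edge of P (n+2) leaves P 1 ⊕ P (n+1), P (n+1) and P n, so the path values obey
-- the linear recurrence p (n+2) = (x+y) p (n+1) + z p n, whose generating function has denominator
-- 1 - (x+y)t - zt². Eliminating the closing edge of C (n+2) leaves P (n+2), C (n+1) and P n, hence
-- c (n+2) - y c (n+1) = p (n+2) + z p n; together with the loop C 1 this says
-- (1 - yt) C(t) = (1 + zt²) P(t) + (xy - y + z) t. Multiplying by 1 - (x+y)t - zt² and substituting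
-- the path identity gives the cycle identity, using only that the Cauchy product is commutative,
-- associative and distributes over addition.

open import Defs
open import Data.Nat using (ℕ; zero; suc)
open import Data.Fin using (Fin; zero; suc; fromℕ)
open import Data.Fin.Properties using (_≟_)
open import Data.List using (List; []; _∷_; map; mapMaybe)
open import Data.List.Properties
  using (map-∘; map-id; map-cong; mapMaybe-map; map-mapMaybe; mapMaybe-cong; mapMaybe-map-retract)
open import Data.Maybe as Maybe using (just; nothing)
open import Data.Product using (_×_; _,_)
open import Data.Empty using (⊥-elim)
open import Function using (_∘_)
open import Relation.Nullary using (yes; no)
open import Relation.Binary.PropositionalEquality
  using (_≡_; _≢_; refl; cong; cong₂; module ≡-Reasoning)
open import Relation.Binary.Bundles using (Setoid)
open import Function.Indexed.Relation.Binary.Equality using (≡-setoid)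
import Relation.Binary.Indexed.Heterogeneous.Construct.Trivial as Trivial
open import Algebra.Bundles using (CommutativeRing; CommutativeSemigroup)
open import Algebra.Structures using (IsCommutativeSemigroup)
import Algebra.Properties.CommutativeSemigroup as CommutativeSemigroupProperties

sucEdge : ∀ {n} → Fin n × Fin n → Fin (suc n) × Fin (suc n)
sucEdge (a , b) = suc a , suc b

-- By eta for pairs this is definitionally the relabelling performed by identify.
mapEdges : ∀ {m n} → (Fin m → Fin n) → List (Fin m × Fin m) → List (Fin n × Fin n)
mapEdges f = map (λ { (a , b) → f a , f b })

mapEdges-sucEdge : ∀ {n} (f : Fin (suc n) → Fin n) → (∀ a → f (suc a) ≡ a) →
                   (es : List (Fin n × Fin n)) → mapEdges f (map sucEdge es) ≡ es
mapEdges-sucEdge f f∘suc≗id es = begin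
  mapEdges f (map sucEdge es) ≡⟨ map-∘ es ⟨
  map _ es                    ≡⟨ map-cong (λ { (a , b) → cong₂ _,_ (f∘suc≗id a) (f∘suc≗id b) }) es ⟩
  map (λ e → e) es            ≡⟨ map-id es ⟩
  es                          ∎
  where open ≡-Reasoning

dropAt-zero-sucEdge : ∀ {n} (e : Fin n × Fin n) → dropAt zero (sucEdge e) ≡ just e
dropAt-zero-sucEdge (a , b) = refl

dropAt-suc-sucEdge : ∀ {n} (j : Fin (suc n)) (e : Fin (suc n) × Fin (suc n)) →
                     dropAt (suc j) (sucEdge e) ≡ Maybe.map sucEdge (dropAt j e)
dropAt-suc-sucEdge j (a , b) with a ≟ j | b ≟ j
... | yes _ | _     = refl
... | no _  | yes _ = refl
... | no _  | no _  = refl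

dropAt-incidentˡ : ∀ {n} (j b : Fin (suc n)) → dropAt j (j , b) ≡ nothing
dropAt-incidentˡ j b with j ≟ j
... | yes _  = refl
... | no j≢j = ⊥-elim (j≢j refl)

mapMaybe-dropAt-suc : ∀ {n} (j : Fin (suc n)) (es : List (Fin (suc n) × Fin (suc n))) →
                      mapMaybe (dropAt (suc j)) (map sucEdge es) ≡ map sucEdge (mapMaybe (dropAt j) es)
mapMaybe-dropAt-suc j es = begin
  mapMaybe (dropAt (suc j)) (map sucEdge es)  ≡⟨ mapMaybe-map _ _ es ⟩
  mapMaybe (dropAt (suc j) ∘ sucEdge) es      ≡⟨ mapMaybe-cong (dropAt-suc-sucEdge j) es ⟩
  mapMaybe (Maybe.map sucEdge ∘ dropAt j) es  ≡⟨ map-mapMaybe _ _ es ⟨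
  map sucEdge (mapMaybe (dropAt j) es)        ∎
  where open ≡-Reasoning

mapMaybe-dropAt-first-P : ∀ n → mapMaybe (dropAt zero) (pathEdges (suc n)) ≡ pathEdges n
mapMaybe-dropAt-first-P zero    = refl
mapMaybe-dropAt-first-P (suc n) = mapMaybe-map-retract dropAt-zero-sucEdge (pathEdges (suc n))

mapMaybe-dropAt-last-P : ∀ n → mapMaybe (dropAt (fromℕ n)) (pathEdges (suc n)) ≡ pathEdges n
mapMaybe-dropAt-last-P zero          = refl
mapMaybe-dropAt-last-P (suc zero)    = refl
mapMaybe-dropAt-last-P (suc (suc n)) = cong ((zero , suc zero) ∷_) (begin
  mapMaybe (dropAt (suc (fromℕ (suc n)))) (map sucEdge (pathEdges (suc (suc n))))
    ≡⟨ mapMaybe-dropAt-suc (fromℕ (suc n)) (pathEdges (suc (suc n))) ⟩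
  map sucEdge (mapMaybe (dropAt (fromℕ (suc n))) (pathEdges (suc (suc n))))
    ≡⟨ cong (map sucEdge) (mapMaybe-dropAt-last-P (suc n)) ⟩
  map sucEdge (pathEdges (suc n)) ∎)
  where open ≡-Reasoning

mapMaybe-dropAt-last-C : ∀ n → mapMaybe (dropAt (fromℕ n)) (E (C (suc n))) ≡ pathEdges n
mapMaybe-dropAt-last-C n rewrite dropAt-incidentˡ (fromℕ n) zero = mapMaybe-dropAt-last-P n

mergeVertex-01-suc : ∀ {n} (0≢1 : zero ≢ suc zero) (a : Fin (suc n)) →
                     mergeVertex zero (suc zero) 0≢1 (suc a) ≡ a
mergeVertex-01-suc 0≢1 zero    = refl
mergeVertex-01-suc 0≢1 (suc a) = refl

contractEdge-P : ∀ n → contractEdge (P (suc (suc n))) zero ≡ P (suc n)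
contractEdge-P n =
  cong (graph (suc n)) (mapEdges-sucEdge _ (mergeVertex-01-suc _) (pathEdges (suc n)))

daggerEdge-P : ∀ n → daggerEdge (P (suc (suc n))) zero ≡ P n
daggerEdge-P n = begin
  daggerEdge (P (suc (suc n))) zero
    ≡⟨⟩
  minusVertex (graph (suc n) (mapEdges (mergeVertex zero (suc zero) _) (map sucEdge (pathEdges (suc n))))) zero
    ≡⟨ cong (λ es → minusVertex (graph (suc n) es) zero)
            (mapEdges-sucEdge _ (mergeVertex-01-suc _) (pathEdges (suc n))) ⟩
  minusVertex (P (suc n)) zero
    ≡⟨ cong (graph n) (mapMaybe-dropAt-first-P n) ⟩
  P n ∎
  where open ≡-Reasoning

-- Contracting the closing edge merges vertex 0 into the last vertex, which becomes fromℕ n.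
contractEdge-C : ∀ n → contractEdge (C (suc (suc n))) zero ≡ C (suc n)
contractEdge-C n =
  cong (λ es → graph (suc n) ((fromℕ n , zero) ∷ es)) (mapEdges-sucEdge _ (λ _ → refl) (pathEdges (suc n)))

daggerEdge-C : ∀ n → daggerEdge (C (suc (suc n))) zero ≡ P n
daggerEdge-C n = begin
  daggerEdge (C (suc (suc n))) zero
    ≡⟨⟩
  minusVertex (graph (suc n) ((fromℕ n , zero) ∷ mapEdges (mergeVertex (fromℕ (suc n)) zero _)
                                                         (map sucEdge (pathEdges (suc n))))) (fromℕ n)
    ≡⟨ cong (λ es → minusVertex (graph (suc n) ((fromℕ n , zero) ∷ es)) (fromℕ n))
            (mapEdges-sucEdge _ (λ _ → refl) (pathEdges (suc n))) ⟩
  minusVertex (C (suc n)) (fromℕ n)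
    ≡⟨ cong (graph n) (mapMaybe-dropAt-last-C n) ⟩
  P n ∎
  where open ≡-Reasoning

module FormalPowerSeries {r ℓ} (R : CommutativeRing r ℓ) where
  open CommutativeRing R hiding (zero) renaming (refl to ≈-refl)
  open Series R
  open import Algebra.Properties.Ring ring using (-‿distribʳ-*; -‿+-comm; x≈y⇒x∙y⁻¹≈ε)
  open CommutativeSemigroupProperties +-commutativeSemigroup using (x∙yz≈y∙xz; interchange)
  open import Relation.Binary.Reasoning.Setoid setoid

  infixr 7 _*ₗ_
  _*ₗ_ : Carrier → FPS → FPS
  (a *ₗ f) n = a * f n

  FPS-setoid : Setoid r ℓ
  FPS-setoid = ≡-setoid ℕ (Trivial.indexedSetoid setoid)

  ⊛-congˡ : ∀ {f g} h → f ≈ₛ g → (f ⊛ h) ≈ₛ (g ⊛ h)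
  ⊛-congˡ h f≈g zero = *-congʳ (f≈g 0)
  ⊛-congˡ h f≈g (suc n) = +-cong (*-congʳ (f≈g 0)) (⊛-congˡ h (f≈g ∘ suc) n)

  ⊛-sucʳ : ∀ f g n → (f ⊛ g) (suc n) ≈ f (suc n) * g 0 + (f ⊛ (g ∘ suc)) n
  ⊛-sucʳ f g zero = +-comm _ _
  ⊛-sucʳ f g (suc n) = begin
    f 0 * g (suc (suc n)) + ((f ∘ suc) ⊛ g) (suc n)
      ≈⟨ +-congˡ (⊛-sucʳ (f ∘ suc) g n) ⟩
    f 0 * g (suc (suc n)) + (f (suc (suc n)) * g 0 + ((f ∘ suc) ⊛ (g ∘ suc)) n)
      ≈⟨ x∙yz≈y∙xz _ _ _ ⟩
    f (suc (suc n)) * g 0 + (f ⊛ (g ∘ suc)) (suc n) ∎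

  ⊛-comm : ∀ f g → (f ⊛ g) ≈ₛ (g ⊛ f)
  ⊛-comm f g zero = *-comm (f 0) (g 0)
  ⊛-comm f g (suc n) = begin
    f 0 * g (suc n) + ((f ∘ suc) ⊛ g) n ≈⟨ +-cong (*-comm (f 0) (g (suc n))) (⊛-comm (f ∘ suc) g n) ⟩
    g (suc n) * f 0 + (g ⊛ (f ∘ suc)) n ≈⟨ ⊛-sucʳ g f n ⟨
    (g ⊛ f) (suc n) ∎

  ⊛-congʳ : ∀ f {g h} → g ≈ₛ h → (f ⊛ g) ≈ₛ (f ⊛ h)
  ⊛-congʳ f {g} {h} g≈h n = begin
    (f ⊛ g) n ≈⟨ ⊛-comm f g n ⟩
    (g ⊛ f) n ≈⟨ ⊛-congˡ f g≈h n ⟩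
    (h ⊛ f) n ≈⟨ ⊛-comm h f n ⟩
    (f ⊛ h) n ∎

  ⊛-distribʳ : ∀ f g h → ((f ⊞ g) ⊛ h) ≈ₛ ((f ⊛ h) ⊞ (g ⊛ h))
  ⊛-distribʳ f g h zero = distribʳ (h 0) (f 0) (g 0)
  ⊛-distribʳ f g h (suc n) = begin
    (f 0 + g 0) * h (suc n) + (((f ∘ suc) ⊞ (g ∘ suc)) ⊛ h) n
      ≈⟨ +-cong (distribʳ (h (suc n)) (f 0) (g 0)) (⊛-distribʳ (f ∘ suc) (g ∘ suc) h n) ⟩
    (f 0 * h (suc n) + g 0 * h (suc n)) + (((f ∘ suc) ⊛ h) n + ((g ∘ suc) ⊛ h) n)
      ≈⟨ interchange _ _ _ _ ⟩
    (f ⊛ h) (suc n) + (g ⊛ h) (suc n) ∎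

  *ₗ-⊛-assoc : ∀ a f g → ((a *ₗ f) ⊛ g) ≈ₛ (a *ₗ (f ⊛ g))
  *ₗ-⊛-assoc a f g zero = *-assoc a (f 0) (g 0)
  *ₗ-⊛-assoc a f g (suc n) = begin
    a * f 0 * g (suc n) + ((a *ₗ (f ∘ suc)) ⊛ g) n
      ≈⟨ +-cong (*-assoc a (f 0) (g (suc n))) (*ₗ-⊛-assoc a (f ∘ suc) g n) ⟩
    a * (f 0 * g (suc n)) + a * ((f ∘ suc) ⊛ g) n ≈⟨ distribˡ a _ _ ⟨
    a * (f ⊛ g) (suc n) ∎

  -- (f ⊛ g) ∘ suc is definitionally (f 0 *ₗ (g ∘ suc)) ⊞ ((f ∘ suc) ⊛ g).
  ⊛-assoc : ∀ f g h → ((f ⊛ g) ⊛ h) ≈ₛ (f ⊛ (g ⊛ h))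
  ⊛-assoc f g h zero = *-assoc (f 0) (g 0) (h 0)
  ⊛-assoc f g h (suc n) = begin
    f 0 * g 0 * h (suc n) + (((f 0 *ₗ (g ∘ suc)) ⊞ ((f ∘ suc) ⊛ g)) ⊛ h) n
      ≈⟨ +-congˡ (⊛-distribʳ (f 0 *ₗ (g ∘ suc)) ((f ∘ suc) ⊛ g) h n) ⟩
    f 0 * g 0 * h (suc n) + (((f 0 *ₗ (g ∘ suc)) ⊛ h) n + (((f ∘ suc) ⊛ g) ⊛ h) n)
      ≈⟨ +-congˡ (+-cong (*ₗ-⊛-assoc (f 0) (g ∘ suc) h n) (⊛-assoc (f ∘ suc) g h n)) ⟩
    f 0 * g 0 * h (suc n) + (f 0 * ((g ∘ suc) ⊛ h) n + ((f ∘ suc) ⊛ (g ⊛ h)) n)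
      ≈⟨ +-assoc _ _ _ ⟨
    f 0 * g 0 * h (suc n) + f 0 * ((g ∘ suc) ⊛ h) n + ((f ∘ suc) ⊛ (g ⊛ h)) n
      ≈⟨ +-congʳ (trans (+-congʳ (*-assoc (f 0) (g 0) (h (suc n)))) (sym (distribˡ (f 0) _ _))) ⟩
    (f ⊛ (g ⊛ h)) (suc n) ∎

  ⊛-isCommutativeSemigroup : IsCommutativeSemigroup _≈ₛ_ _⊛_
  ⊛-isCommutativeSemigroup = record
    { isSemigroup = record
      { isMagma = record
        { isEquivalence = Setoid.isEquivalence FPS-setoid
        ; ∙-cong = λ {f} {g} {h} f≈g h≈k n → trans (⊛-congˡ h f≈g n) (⊛-congʳ g h≈k n)
        }
      ; assoc = ⊛-assoc
      }
    ; comm = ⊛-comm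
    }

  ⊛-commutativeSemigroup : CommutativeSemigroup r ℓ
  ⊛-commutativeSemigroup = record { isCommutativeSemigroup = ⊛-isCommutativeSemigroup }

  ⊛-zeroʳ : ∀ f n → (f ⊛ poly []) n ≈ 0#
  ⊛-zeroʳ f zero    = zeroʳ (f 0)
  ⊛-zeroʳ f (suc n) = trans (+-cong (zeroʳ (f 0)) (⊛-zeroʳ (f ∘ suc) n)) (+-identityʳ 0#)

  ⊛-poly₁ʳ : ∀ f a n → (f ⊛ poly (a ∷ [])) n ≈ f n * a
  ⊛-poly₁ʳ f a zero    = ≈-refl
  ⊛-poly₁ʳ f a (suc n) = trans (⊛-sucʳ f _ n) (trans (+-congˡ (⊛-zeroʳ f n)) (+-identityʳ _))

  ⊛-poly₂ʳ : ∀ f a₀ a₁ n → (f ⊛ poly (a₀ ∷ a₁ ∷ [])) (suc n) ≈ f (suc n) * a₀ + f n * a₁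
  ⊛-poly₂ʳ f a₀ a₁ n = trans (⊛-sucʳ f _ n) (+-congˡ (⊛-poly₁ʳ f a₁ n))

  ⊛-poly₃ʳ : ∀ f a₀ a₁ a₂ n → (f ⊛ poly (a₀ ∷ a₁ ∷ a₂ ∷ [])) (suc (suc n))
                              ≈ f (suc (suc n)) * a₀ + (f (suc n) * a₁ + f n * a₂)
  ⊛-poly₃ʳ f a₀ a₁ a₂ n = trans (⊛-sucʳ f _ (suc n)) (+-congˡ (⊛-poly₂ʳ f a₁ a₂ n))

  x*-y≈-yx : ∀ u v → u * - v ≈ - (v * u)
  x*-y≈-yx u v = trans (sym (-‿distribʳ-* u v)) (-‿cong (*-comm u v))

  ⊛-[1-αt] : ∀ f α n → (f ⊛ poly (1# ∷ - α ∷ [])) (suc n) ≈ f (suc n) - α * f n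
  ⊛-[1-αt] f α n = trans (⊛-poly₂ʳ f 1# (- α) n) (+-cong (*-identityʳ _) (x*-y≈-yx (f n) α))

  ⊛-[1-αt-βt²] : ∀ f α β n → (f ⊛ poly (1# ∷ - α ∷ - β ∷ [])) (suc (suc n))
                             ≈ f (suc (suc n)) - (α * f (suc n) + β * f n)
  ⊛-[1-αt-βt²] f α β n = begin
    (f ⊛ poly (1# ∷ - α ∷ - β ∷ [])) (suc (suc n))
      ≈⟨ ⊛-poly₃ʳ f 1# (- α) (- β) n ⟩
    f (suc (suc n)) * 1# + (f (suc n) * - α + f n * - β)
      ≈⟨ +-cong (*-identityʳ _) (+-cong (x*-y≈-yx _ α) (x*-y≈-yx _ β)) ⟩
    f (suc (suc n)) + (- (α * f (suc n)) + - (β * f n))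
      ≈⟨ +-congˡ (-‿+-comm _ _) ⟩
    f (suc (suc n)) - (α * f (suc n) + β * f n) ∎

  linear-recurrence⇒rational : ∀ f α β → (∀ n → f (suc (suc n)) ≈ α * f (suc n) + β * f n) →
                               (f ⊛ poly (1# ∷ - α ∷ - β ∷ [])) ≈ₛ poly (f 0 ∷ f 1 - α * f 0 ∷ [])
  linear-recurrence⇒rational f α β rec zero          = *-identityʳ (f 0)
  linear-recurrence⇒rational f α β rec (suc zero)    =
    trans (⊛-sucʳ f (poly (1# ∷ - α ∷ - β ∷ [])) 0) (+-cong (*-identityʳ (f 1)) (x*-y≈-yx (f 0) α))
  linear-recurrence⇒rational f α β rec (suc (suc n)) =
    trans (⊛-[1-αt-βt²] f α β n) (x≈y⇒x∙y⁻¹≈ε (rec n))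

module EdgeElimination {r ℓ} (R : CommutativeRing r ℓ) {x y z : CommutativeRing.Carrier R}
                       {ξ : Graph → CommutativeRing.Carrier R} (isXi : IsXi R x y z ξ) where
  open CommutativeRing R hiding (zero) renaming (refl to ≈-refl)
  open Series R
  open FormalPowerSeries R
  open IsXi isXi
  open import Algebra.Properties.Ring ring using (-‿+-comm; \\-leftDividesˡ; //-rightDividesʳ)
  open CommutativeSemigroupProperties +-commutativeSemigroup using (x∙yz≈y∙xz; x∙yz≈xz∙y)
  open import Relation.Binary.Reasoning.Setoid setoid

  p c : FPS
  p n = ξ (P n)
  c n = ξ (C n)

  -- Deleting edge 0 of P (2+n) resp. C (2+n) gives P 1 ⊕ P (1+n) resp. P (2+n) definitionally.
  p-recurrence : ∀ n → p (suc (suc n)) ≈ (x + y) * p (suc n) + z * p n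
  p-recurrence n = begin
    p (suc (suc n))
      ≈⟨ elim (P (suc (suc n))) zero ⟩
    ξ (P 1 ⊕ P (suc n)) + (y * ξ (contractEdge (P (suc (suc n))) zero) + z * ξ (daggerEdge (P (suc (suc n))) zero))
      ≡⟨ cong₂ (λ G H → ξ (P 1 ⊕ P (suc n)) + (y * ξ G + z * ξ H)) (contractEdge-P n) (daggerEdge-P n) ⟩
    ξ (P 1 ⊕ P (suc n)) + (y * p (suc n) + z * p n)
      ≈⟨ +-congʳ (trans (mult (P 1) (P (suc n))) (*-congʳ single)) ⟩
    x * p (suc n) + (y * p (suc n) + z * p n)
      ≈⟨ +-assoc _ _ _ ⟨
    x * p (suc n) + y * p (suc n) + z * p n
      ≈⟨ +-congʳ (distribʳ (p (suc n)) x y) ⟨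
    (x + y) * p (suc n) + z * p n ∎

  c-recurrence : ∀ n → c (suc (suc n)) ≈ p (suc (suc n)) + (y * c (suc n) + z * p n)
  c-recurrence n = begin
    c (suc (suc n))
      ≈⟨ elim (C (suc (suc n))) zero ⟩
    p (suc (suc n)) + (y * ξ (contractEdge (C (suc (suc n))) zero) + z * ξ (daggerEdge (C (suc (suc n))) zero))
      ≡⟨ cong₂ (λ G H → p (suc (suc n)) + (y * ξ G + z * ξ H)) (contractEdge-C n) (daggerEdge-C n) ⟩
    p (suc (suc n)) + (y * c (suc n) + z * p n) ∎

  c₁-value : c 1 ≈ x + (y * x + z)
  c₁-value = begin
    c 1                               ≈⟨ elim (C 1) zero ⟩
    p 1 + (y * p 1 + z * p 0)         ≈⟨ +-cong single (+-cong (*-congˡ single) (*-congˡ empty)) ⟩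
    x + (y * x + z * 1#)              ≈⟨ +-congˡ (+-congˡ (*-identityʳ z)) ⟩
    x + (y * x + z)                   ∎

  p⊛[1-[x+y]t-zt²]≈1-yt : (p ⊛ poly (1# ∷ - (x + y) ∷ - z ∷ [])) ≈ₛ poly (1# ∷ - y ∷ [])
  p⊛[1-[x+y]t-zt²]≈1-yt n = trans (linear-recurrence⇒rational p (x + y) z p-recurrence n) (initial n)
    where
    initial : poly (p 0 ∷ p 1 - (x + y) * p 0 ∷ []) ≈ₛ poly (1# ∷ - y ∷ [])
    initial zero          = empty
    initial (suc zero)    = begin
      p 1 - (x + y) * p 0 ≈⟨ +-cong single (-‿cong (trans (*-congˡ empty) (*-identityʳ (x + y)))) ⟩
      x - (x + y)         ≈⟨ +-congˡ (-‿+-comm x y) ⟨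
      x + (- x + - y)     ≈⟨ \\-leftDividesˡ x (- y) ⟩
      - y                 ∎
    initial (suc (suc n)) = ≈-refl

  -- C 0 and P 0 are both the empty graph, so c 0 and p 0 coincide definitionally.
  c⊛[1-yt]≈p⊛[1+zt²]⊞[xy-y+z]t : (c ⊛ poly (1# ∷ - y ∷ []))
                                   ≈ₛ ((p ⊛ poly (1# ∷ 0# ∷ z ∷ [])) ⊞ poly (0# ∷ (x * y - y + z) ∷ []))
  c⊛[1-yt]≈p⊛[1+zt²]⊞[xy-y+z]t zero          = sym (+-identityʳ _)
  c⊛[1-yt]≈p⊛[1+zt²]⊞[xy-y+z]t (suc zero)    = begin
    p 0 * - y + c 1 * 1#
      ≈⟨ +-cong (trans (*-congʳ empty) (*-identityˡ (- y))) (trans (*-identityʳ (c 1)) c₁-value) ⟩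
    - y + (x + (y * x + z))
      ≈⟨ x∙yz≈y∙xz (- y) x _ ⟩
    x + (- y + (y * x + z))
      ≈⟨ +-congˡ (trans (sym (+-assoc (- y) (y * x) z)) (+-congʳ (trans (+-comm (- y) (y * x)) (+-congʳ (*-comm y x))))) ⟩
    x + (x * y - y + z)
      ≈⟨ +-congʳ (trans (+-congʳ (zeroʳ (p 0))) (trans (+-identityˡ _) (trans (*-identityʳ (p 1)) single))) ⟨
    (p 0 * 0# + p 1 * 1#) + (x * y - y + z) ∎
  c⊛[1-yt]≈p⊛[1+zt²]⊞[xy-y+z]t (suc (suc n)) = begin
    (c ⊛ poly (1# ∷ - y ∷ [])) (suc (suc n))
      ≈⟨ ⊛-[1-αt] c y (suc n) ⟩
    c (suc (suc n)) - y * c (suc n)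
      ≈⟨ +-congʳ (c-recurrence n) ⟩
    p (suc (suc n)) + (y * c (suc n) + z * p n) - y * c (suc n)
      ≈⟨ +-congʳ (x∙yz≈xz∙y _ _ _) ⟩
    p (suc (suc n)) + z * p n + y * c (suc n) - y * c (suc n)
      ≈⟨ //-rightDividesʳ _ _ ⟩
    p (suc (suc n)) + z * p n
      ≈⟨ +-cong (*-identityʳ _) (trans (+-cong (zeroʳ (p (suc n))) (*-comm (p n) z)) (+-identityˡ _)) ⟨
    p (suc (suc n)) * 1# + (p (suc n) * 0# + p n * z)
      ≈⟨ trans (+-identityʳ _) (⊛-poly₃ʳ p 1# 0# z n) ⟨
    ((p ⊛ poly (1# ∷ 0# ∷ z ∷ [])) ⊞ poly (0# ∷ (x * y - y + z) ∷ [])) (suc (suc n)) ∎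

corollary1 : ∀ {c ℓ} (R : CommutativeRing c ℓ) → let open CommutativeRing R in let open Series R in
    (x y z : Carrier) (ξ : Graph → Carrier) → IsXi R x y z ξ →
      (((λ n → ξ (P n)) ⊛ poly (1# ∷ - (x + y) ∷ - z ∷ [])) ≈ₛ poly (1# ∷ - y ∷ []))
      × ((((λ n → ξ (C n)) ⊛ poly (1# ∷ - (x + y) ∷ - z ∷ [])) ⊛ poly (1# ∷ - y ∷ []))
          ≈ₛ ((poly (1# ∷ 0# ∷ z ∷ []) ⊛ poly (1# ∷ - y ∷ []))
              ⊞ (poly (0# ∷ (x * y - y + z) ∷ []) ⊛ poly (1# ∷ - (x + y) ∷ - z ∷ []))))
corollary1 R x y z ξ isXi = p⊛[1-[x+y]t-zt²]≈1-yt , c-series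
  where
  open CommutativeRing R using (1#; 0#; _+_; _*_; _-_; -_; +-congʳ)
  open Series R
  open FormalPowerSeries R
  open EdgeElimination R isXi
  open CommutativeSemigroupProperties ⊛-commutativeSemigroup using (xy∙z≈xz∙y)
  open import Relation.Binary.Reasoning.Setoid FPS-setoid

  Q L A K : FPS
  Q = poly (1# ∷ - (x + y) ∷ - z ∷ [])
  L = poly (1# ∷ - y ∷ [])
  A = poly (1# ∷ 0# ∷ z ∷ [])
  K = poly (0# ∷ (x * y - y + z) ∷ [])

  c-series : ((c ⊛ Q) ⊛ L) ≈ₛ ((A ⊛ L) ⊞ (K ⊛ Q))
  c-series = begin
    (c ⊛ Q) ⊛ L              ≈⟨ xy∙z≈xz∙y c Q L ⟩
    (c ⊛ L) ⊛ Q              ≈⟨ ⊛-congˡ Q c⊛[1-yt]≈p⊛[1+zt²]⊞[xy-y+z]t ⟩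
    ((p ⊛ A) ⊞ K) ⊛ Q        ≈⟨ ⊛-distribʳ (p ⊛ A) K Q ⟩
    ((p ⊛ A) ⊛ Q) ⊞ (K ⊛ Q)  ≈⟨ (λ n → +-congʳ (pA⊛Q≈A⊛L n)) ⟩
    (A ⊛ L) ⊞ (K ⊛ Q)        ∎
    where
    pA⊛Q≈A⊛L : ((p ⊛ A) ⊛ Q) ≈ₛ (A ⊛ L)
    pA⊛Q≈A⊛L = begin
      (p ⊛ A) ⊛ Q  ≈⟨ xy∙z≈xz∙y p A Q ⟩
      (p ⊛ Q) ⊛ A  ≈⟨ ⊛-congˡ A p⊛[1-[x+y]t-zt²]≈1-yt ⟩
      L ⊛ A        ≈⟨ ⊛-comm L A ⟩
      A ⊛ L        ∎
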